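{- Let $n\geq 2$ be an integer, let $\mathcal{F}=(W,R)$ be a finite transitive frame with set of clusters $\mathscr{C}$, and let $X_\mathcal{F}$ be constructed from spaces $X_C$ ($C\in\mathscr{C}$) as described in the context. If $X_C$ is hereditarily $n$-irresolvable for every $C\in\mathscr{C}$, then $X_\mathcal{F}$ is hereditarily $n$-irresolvable.
   Context: For an integer $k\geq 2$, a space $Y$ is $k$-resolvable if it has $k$ pairwise disjoint non-empty subsets each dense in $Y$; it is hereditarily $k$-irresolvable if no non-empty subspace of $Y$ is $k$-resolvable. For a transitive frame $(W,R)$, a cluster is an equivalence class of $\{(x,y): x=y \text{ or } xRyRx\}$; it is degenerate if it is a singleton $\{x\}$ with $x$ irreflexive, non-degenerate otherwise. For clusters write $CR^\uparrow C'$ iff $xRy$ for $x\in C,y\in C'$ but not $yRx$. A crowded dense $k$-partition of a space $Y$ is a partition of $Y$ into $k$ non-empty cells each dense in $Y$ and each having no isolated points as a subspace. Construction: for each cluster $C$ choose a space $X_C$ with a partition $\{X_w:w\in C\}$: if $C=\{w\}$ is degenerate, $X_C=X_w=\{w\}$ is a one-point space; if $C=\{w_1,\dots,w_k\}$ is non-degenerate, $X_C$ is a space with a crowded dense $k$-partition with cells $X_{w_1},\dots,X_{w_k}$. The $X_C$ are pairwise disjoint. $X_\mathcal{F}=\bigcup_C X_C$, with $O\subseteq X_\mathcal{F}$ open iff for every cluster $C$, $O\cap X_C$ is open in $X_C$ and, if $O\cap X_C\neq\emptyset$, then $X_{C'}\subseteq O$ whenever $CR^\uparrow C'$. -}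

module Defs where

open import Data.Nat using (ℕ)
open import Data.Fin using (Fin)
open import Data.Product using (Σ; ∃; _×_; _,_)
open import Data.Sum using (_⊎_)
open import Data.Unit using (⊤)
open import Data.Empty using (⊥)
open import Relation.Nullary using (¬_)
open import Relation.Binary.PropositionalEquality using (_≡_; _≢_)

Subset : Set → Set₁
Subset X = X → Set

OpenPred : Set → Set₁
OpenPred X = Subset X → Set

record Topology (X : Set) : Set₁ where
  field
    Open      : OpenPred X
    open-resp : ∀ {U V : Subset X} → (∀ x → U x → V x) → (∀ x → V x → U x) → Open U → Open V
    open-univ : Open (λ _ → ⊤)
    open-∩    : ∀ {U V : Subset X} → Open U → Open V → Open (λ x → U x × V x)
    open-⋃    : ∀ {I : Set} (F : I → Subset X) → (∀ i → Open (F i)) → Open (λ x → ∃ λ i → F i x)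

module _ {X : Set} (Op : OpenPred X) where

  -- D is a dense subset of the subspace Y (D ⊆ Y, and D meets every
  -- non-empty open set of the subspace Y, i.e. every O ∩ Y ≠ ∅ with O open)
  DenseIn : Subset X → Subset X → Set₁
  DenseIn Y D = (∀ x → D x → Y x)
              × (∀ (O : Subset X) → Op O → (∃ λ y → Y y × O y) → ∃ λ d → D d × O d)

  Resolvable : ℕ → Subset X → Set₁
  Resolvable k Y = Σ (Fin k → Subset X) λ D →
      (∀ i j → i ≢ j → ∀ x → D i x → D j x → ⊥)
    × (∀ i → (∃ λ x → D i x) × DenseIn Y (D i))

  HereditarilyIrresolvable : ℕ → Set₁
  HereditarilyIrresolvable k = ∀ (Y : Subset X) → (∃ λ y → Y y) → ¬ Resolvable k Y

  Isolated : Subset X → X → Set₁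
  Isolated A p = A p × Σ (Subset X) λ O → Op O × O p × (∀ q → A q → O q → q ≡ p)

  Crowded : Subset X → Set₁
  Crowded A = ∀ p → ¬ Isolated A p

record FiniteTransitiveFrame : Set₁ where
  field
    size  : ℕ
    R     : Fin size → Fin size → Set
    trans : ∀ {a b c} → R a b → R b c → R a c
  W : Set
  W = Fin size
  _∼_ : W → W → Set
  x ∼ y = x ≡ y ⊎ (R x y × R y x)

-- The set of clusters: a type Cl with a surjection cl : W → Cl whose
-- kernel is exactly the cluster equivalence ∼ (i.e. Cl ≅ W/∼).
record Clusters (F : FiniteTransitiveFrame) : Set₁ where
  open FiniteTransitiveFrame F
  field
    Cl      : Set
    cl      : W → Cl
    cl-surj : ∀ (C : Cl) → ∃ λ w → cl w ≡ C
    cl-ker₁ : ∀ w v → cl w ≡ cl v → w ∼ v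
    cl-ker₂ : ∀ w v → w ∼ v → cl w ≡ cl v

  Degenerate : Cl → Set
  Degenerate C = Σ W λ w → cl w ≡ C × (∀ v → cl v ≡ C → v ≡ w) × ¬ R w w

  _R↑_ : Cl → Cl → Set
  C R↑ C' = Σ W λ x → Σ W λ y → cl x ≡ C × cl y ≡ C' × R x y × ¬ R y x

record Construction (F : FiniteTransitiveFrame) (S : Clusters F) : Set₁ where
  open FiniteTransitiveFrame F
  open Clusters S
  field
    XC     : Cl → Set
    top    : ∀ C → Topology (XC C)
    -- part C x = w  means  x ∈ X_w ;  the cells X_w (w ∈ C) partition X_C
    part   : ∀ C → XC C → W
    part-cl : ∀ C x → cl (part C x) ≡ C
    degen  : ∀ C → Degenerate C → Σ (XC C) λ x → ∀ y → y ≡ x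
    nondeg : ∀ C → ¬ Degenerate C → ∀ w → cl w ≡ C →
               (∃ λ x → part C x ≡ w)
             × DenseIn (Topology.Open (top C)) (λ _ → ⊤) (λ x → part C x ≡ w)
             × Crowded (Topology.Open (top C)) (λ x → part C x ≡ w)

  XF : Set
  XF = Σ Cl XC

  OpenF : OpenPred XF
  OpenF O = ∀ C → Topology.Open (top C) (λ x → O (C , x))
                × ((∃ λ x → O (C , x)) → ∀ C' → C R↑ C' → ∀ y → O (C' , y))

-- The strict order R↑ on clusters is irreflexive and transitive, so, the frame being finite,
-- it admits induction towards the top. Suppose Y ⊆ X_F is non-empty and n-resolvable, and
-- take a cluster C, maximal among those whose X_C meets Y. Every open O of X_C extends to the
-- open set O ∪ ⋃{X_C' : C R↑ C'} of X_F, which meets Y only inside O; hence the traces on X_C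
-- of the n disjoint dense subsets of Y are dense in Y ∩ X_C, which makes the non-empty subspace
-- Y ∩ X_C of X_C n-resolvable.
module Submission where

open import Defs
open import Data.Nat using (ℕ; _≤_)
open import Data.Product using (Σ; ∃; _×_; _,_; proj₂)
open import Data.Sum using (_⊎_; inj₁; inj₂)
open import Data.Unit using (⊤; tt)
open import Data.Empty using (⊥-elim)
open import Data.Fin.Induction using (spo-noetherian)
open import Induction.WellFounded using (module All)
open import Relation.Nullary using (¬_)
open import Relation.Binary.Core using (Rel)
open import Relation.Binary.Structures using (IsStrictPartialOrder)
open import Relation.Binary.PropositionalEquality using (_≡_; refl; sym; subst; resp₂; isEquivalence)

module ClusterOrder (F : FiniteTransitiveFrame) (S : Clusters F) where
  open FiniteTransitiveFrame F
  open Clusters S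

  R-respʳ-cluster : ∀ {x y y'} → cl y ≡ cl y' → R x y → R x y'
  R-respʳ-cluster {y = y} {y'} eq rxy with cl-ker₁ y y' eq
  ... | inj₁ refl       = rxy
  ... | inj₂ (ryy' , _) = trans rxy ryy'

  R↑-irrefl : ∀ {C} → ¬ C R↑ C
  R↑-irrefl (x , y , refl , cly≡clx , rxy , ¬ryx) with cl-ker₁ x y (sym cly≡clx)
  ... | inj₁ refl       = ¬ryx rxy
  ... | inj₂ (_ , ryx) = ¬ryx ryx

  R↑-trans : ∀ {A B C} → A R↑ B → B R↑ C → A R↑ C
  R↑-trans (x , y , clx , refl , rxy , _) (y' , z , cly' , clz , ry'z , ¬rzy') =
    x , z , clx , clz , trans (R-respʳ-cluster (sym cly') rxy) ry'z ,
    λ rzx → ¬rzy' (R-respʳ-cluster (sym cly') (trans rzx rxy))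

  -- R↑ pulled back to W = Fin size, where finiteness makes it well-founded upwards.
  _⊏_ : Rel W _
  w ⊏ v = cl w R↑ cl v

  ⊏-isStrictPartialOrder : IsStrictPartialOrder _≡_ _⊏_
  ⊏-isStrictPartialOrder = record
    { isEquivalence = isEquivalence
    ; irrefl        = λ { refl → R↑-irrefl }
    ; trans         = R↑-trans
    ; <-resp-≈      = resp₂ _⊏_
    }

  R↑-induction : ∀ {ℓ} (Q : Cl → Set ℓ) → (∀ C → (∀ {C'} → C R↑ C' → Q C') → Q C) → ∀ C → Q C
  R↑-induction {ℓ} Q step C with cl-surj C
  ... | w , refl = All.wfRec (spo-noetherian ⊏-isStrictPartialOrder) ℓ (λ v → Q (cl v)) go w
    where
    go : ∀ v → (∀ {u} → v ⊏ u → Q (cl u)) → Q (cl v)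
    go v ih = step (cl v) above
      where
      above : ∀ {C'} → cl v R↑ C' → Q C'
      above {C'} r with cl-surj C'
      ... | u , refl = ih r

module _ {F : FiniteTransitiveFrame} {S : Clusters F} (D : Construction F S) where
  open Clusters S
  open Construction D
  open Topology
  open ClusterOrder F S

  trace : (C : Cl) → Subset XF → Subset (XC C)
  trace C Y x = Y (C , x)

  EmptyAbove : Cl → Subset XF → Set
  EmptyAbove C Y = ∀ {C'} → C R↑ C' → ∀ y → ¬ Y (C' , y)

  -- Cl has no decidable equality, so membership in X_C is witnessed by a proof of C' ≡ C.
  upClosure : (C : Cl) → Subset (XC C) → Subset XF
  upClosure C O (C' , y) = (Σ (C' ≡ C) λ p → O (subst XC p y)) ⊎ C R↑ C'

  upClosure-open : ∀ C {O} → Open (top C) O → OpenF (upClosure C O)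
  upClosure-open C {O} openO C' = openInC' , upward
    where
    piece : (C' ≡ C) ⊎ C R↑ C' → Subset (XC C')
    piece (inj₁ p) y = O (subst XC p y)
    piece (inj₂ _) _ = ⊤

    piece-open : ∀ i → Open (top C') (piece i)
    piece-open (inj₁ refl) = openO
    piece-open (inj₂ _)    = open-univ (top C')

    openInC' : Open (top C') (trace C' (upClosure C O))
    openInC' = open-resp (top C')
      (λ { _ (inj₁ p , o) → inj₁ (p , o) ; _ (inj₂ r , _) → inj₂ r })
      (λ { _ (inj₁ (p , o)) → inj₁ p , o ; _ (inj₂ r) → inj₂ r , tt })
      (open-⋃ (top C') piece piece-open)

    upward : ∃ (trace C' (upClosure C O)) → ∀ C'' → C' R↑ C'' → ∀ y → upClosure C O (C'' , y)
    upward (_ , inj₁ (refl , _)) _ r _ = inj₂ r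
    upward (_ , inj₂ r₀)         _ r _ = inj₂ (R↑-trans r₀ r)

  trace-dense : ∀ {C Y E} → EmptyAbove C Y → DenseIn OpenF Y E →
                DenseIn (Open (top C)) (trace C Y) (trace C E)
  trace-dense {C} {Y} {E} emptyAbove (E⊆Y , denseE) = (λ x → E⊆Y (C , x)) , denseInC
    where
    denseInC : ∀ O → Open (top C) O → ∃ (λ y → trace C Y y × O y) → ∃ λ e → trace C E e × O e
    denseInC O openO (y , Yy , Oy)
      with denseE (upClosure C O) (upClosure-open C openO) ((C , y) , Yy , inj₁ (refl , Oy))
    ... | (_ , e) , Ee , inj₁ (refl , Oe) = e , Ee , Oe
    ... | (_ , e) , Ee , inj₂ r          = ⊥-elim (emptyAbove r e (E⊆Y _ Ee))

  trace-resolvable : ∀ {k C Y} → EmptyAbove C Y → ∃ (trace C Y) →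
                     Resolvable OpenF k Y → Resolvable (Open (top C)) k (trace C Y)
  trace-resolvable {C = C} emptyAbove (y , Yy) (E , disjoint , dense) =
    (λ i → trace C (E i)) , (λ i j i≢j x → disjoint i j i≢j (C , x)) , λ i →
      let denseᵢ = trace-dense emptyAbove (proj₂ (dense i))
          e , Ee , _ = proj₂ denseᵢ (λ _ → ⊤) (open-univ (top C)) (y , Yy , tt)
      in (e , Ee) , denseᵢ

mainTheorem4 : (n : ℕ) → 2 ≤ n →
    (F : FiniteTransitiveFrame) (S : Clusters F) (D : Construction F S) →
    (∀ C → HereditarilyIrresolvable (Topology.Open (Construction.top D C)) n) →
    HereditarilyIrresolvable (Construction.OpenF D) n
mainTheorem4 n _ F S D irresolvable Y ((C , x) , Yx) resolvable =
  R↑-induction (λ C → ¬ ∃ (trace D C Y)) missesY C (x , Yx)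
  where
  open Clusters S
  open ClusterOrder F S

  missesY : ∀ C → (∀ {C'} → C R↑ C' → ¬ ∃ (trace D C' Y)) → ¬ ∃ (trace D C Y)
  missesY C missesAbove meets =
    irresolvable C (trace D C Y) meets
      (trace-resolvable D (λ r y Yy → missesAbove r (y , Yy)) meets resolvable)
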